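{- Let $k\ge 2$ and $d\ge 1$, and let $[w]=[w_0w_1\cdots w_{k^d-1}]$ be a de Bruijn word of order $d$ over $\Sigma_k$, indices of $w$ being taken modulo $k^d$. For $0\le i\le k^d-1$, let $u_i\in\{0,1,\ldots,k^d-1\}$ be the integer whose base-$k$ representation on $d$ digits (with leading zeros) is $w_iw_{i+1}\cdots w_{i+d-1}$, so that $(u_0,u_1,\ldots,u_{k^d-1})$ is a Hamiltonian cycle in the graph on $\{0,\ldots,k^d-1\}$ with edges $m\to km+j \bmod k^d$ ($0\le j\le k-1$). Then the inverse standard permutation $\pi^{ -1}_{L}$ of $L=\mathrm{BWT}([w])$ is the cyclic permutation $(u_0\ u_1\ \cdots\ u_{k^d-1})$ (i.e. $\pi_L^{ -1}(u_i)=u_{i+1}$ for all $i$, indices mod $k^d$). In particular, $w_i=\lfloor u_i/k^{d-1}\rfloor$ for every $0\le i\le k^d-1$.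
   Context: $\Sigma_k=\{0,1,\ldots,k-1\}$ with its natural order; words are indexed from $0$. The shift of $w=w_0\cdots w_{n-1}$ is $\sigma(w)=w_{n-1}w_0\cdots w_{n-2}$. A necklace $[w]$ is the conjugacy class of $w$ (the set of its rotations). A de Bruijn word of order $d$ over $\Sigma_k$ is a necklace of length $k^d$ in which each of the $k^d$ words of length $d$ over $\Sigma_k$ occurs exactly once as a cyclic factor. The Burrows–Wheeler matrix of a necklace $[w]$ of length $n$ is the $n\times n$ matrix whose rows are the $n$ rotations $\sigma^i(w)$, $0\le i<n$ (listed with multiplicity), in ascending lexicographic order; its last column, read top to bottom, is the word $\mathrm{BWT}([w])$. The standard permutation of a word $u=u_0\cdots u_{n-1}$ is the permutation $\pi_u$ of $\{0,\ldots,n-1\}$ such that $\pi_u(i)<\pi_u(j)$ iff $u_i<u_j$, or $u_i=u_j$ and $i<j$; $\pi_u^{ -1}$ is its inverse. -}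

module Defs where

open import Data.Nat using (ℕ; zero; suc; _+_; _*_; _∸_; _^_; _≤_; NonZero; z≤n; s≤s; >-nonZero)
open import Data.Nat.Properties using (m^n≢0; ≤-trans)
open import Data.Nat.DivMod using (_%_; m%n<n)
open import Data.Fin using (Fin; toℕ; fromℕ; fromℕ<) renaming (_<_ to _<ᶠ_; _≤_ to _≤ᶠ_)
open import Data.Product using (Σ; ∃; _×_; _,_)
open import Data.Sum using (_⊎_)
open import Function.Definitions using (Bijective)
open import Function.Bundles using (_⇔_)
open import Relation.Binary.PropositionalEquality using (_≡_; _≗_)

Word : ℕ → ℕ → Set
Word k n = Fin n → Fin k

_⊕_ : ∀ {n} → Fin n → ℕ → Fin n
_⊕_ {suc m} i j = fromℕ< (m%n<n (toℕ i + j) (suc m))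

-- The shift σ(w) = w_{n-1} w_0 ⋯ w_{n-2}, i.e. σ(w)_j = w_{j-1 mod n}.
σ : ∀ {k n} → Word k n → Word k n
σ {n = zero}  w = w
σ {n = suc m} w j = w (j ⊕ m)

rot : ∀ {k n} → Word k n → ℕ → Word k n
rot w zero    = w
rot w (suc i) = σ (rot w i)

factor : ∀ {k n} (d : ℕ) → Word k n → Fin n → Word k d
factor d w i j = w (i ⊕ toℕ j)

-- [w] is a de Bruijn word of order d: every word of length d over Σ_k
-- occurs exactly once as a cyclic factor (n = k^d is fixed by the caller).
IsDeBruijn : ∀ {k n} (d : ℕ) → Word k n → Set
IsDeBruijn {k} d w =
  (v : Word k d) → Σ _ λ i → (factor d w i ≗ v) × (∀ j → factor d w j ≗ v → j ≡ i)

LexLt : ∀ {k n} → Word k n → Word k n → Set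
LexLt {n = n} a b =
  Σ (Fin n) λ p → (∀ q → toℕ q Data.Nat.< toℕ p → a q ≡ b q) × (a p <ᶠ b p)

LexLe : ∀ {k n} → Word k n → Word k n → Set
LexLe a b = (a ≗ b) ⊎ LexLt a b

IsBWMatrix : ∀ {k n} → Word k n → (Fin n → Word k n) → Set
IsBWMatrix {n = n} w M =
  (Σ (Fin n → Fin n) λ ρ → Bijective _≡_ _≡_ ρ × (∀ r → M r ≗ rot w (toℕ (ρ r))))
  × (∀ r s → r ≤ᶠ s → LexLe (M r) (M s))

lastCol : ∀ {k n} → (Fin n → Word k n) → Word k n
lastCol {n = zero}  M ()
lastCol {n = suc m} M r = M r (fromℕ m)

IsStdPerm : ∀ {k n} → Word k n → (Fin n → Fin n) → Set
IsStdPerm L π =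
  ∀ i j → (π i <ᶠ π j) ⇔ ((L i <ᶠ L j) ⊎ ((L i ≡ L j) × (i <ᶠ j)))

fromDigits : ∀ {k} (d : ℕ) → Word k d → ℕ
fromDigits zero f = 0
fromDigits {k} (suc d) f = toℕ (f Data.Fin.zero) * k ^ d + fromDigits d (λ j → f (Data.Fin.suc j))

uval : ∀ {k n} (d : ℕ) → Word k n → Fin n → ℕ
uval d w i = fromDigits d (factor d w i)

pow-nonZero : ∀ {k} → 2 ≤ k → ∀ e → NonZero (k ^ e)
pow-nonZero {k} hk e = m^n≢0 k e {{>-nonZero (≤-trans (s≤s z≤n) hk)}}

{-# OPTIONS --safe #-}
-- The rows are sorted and, w being
-- de Bruijn, their length-d prefixes are pairwise distinct; hence the prefix of row r has
-- base-k value exactly r, i.e. the row starting at position i is row u_i. Let next r be the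
-- row starting one position after row r. The last letter of next r is the first letter of r,
-- and letters 1, …, d − 1 of r are the first d − 1 letters of next r, so r < s forces next r
-- to precede next s in the order defining the standard permutation π of the last column. Thus π ∘ next is a
-- strictly increasing self-map of Fin (k ^ d), the identity, and π⁻¹ = next sends u_i to
-- u_(i+1). The second claim reads off the leading digit of u_i.

module Submission where

open import Defs
open import Data.Nat
  using (ℕ; zero; suc; _+_; _*_; _∸_; _^_; _≤_; _<_; z≤n; s≤s; s≤s⁻¹; z<s; s<s;
         NonZero)
open import Data.Nat.Properties
open import Data.Nat.DivMod
  using (_/_; _%_; m%n<n; m%n%n≡m%n; %-distribˡ-+; [m+n]%n≡m%n; [m+kn]%n≡m%n; m<n⇒m%n≡m;
         m*n%n≡0; +-distrib-/; m*n/n≡m; m<n⇒m/n≡0)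
open import Data.Nat.Tactic.RingSolver using (solve-∀)
open import Data.Fin using (Fin; toℕ; fromℕ; fromℕ<; inject₁)
  renaming (zero to fzero; suc to fsuc; _<_ to _<ᶠ_)
open import Data.Fin.Properties
  using (toℕ-injective; toℕ-fromℕ<; toℕ-fromℕ; toℕ<n; toℕ-inject₁; fromℕ<-cong;
         fromℕ<-toℕ; inject₁ℕ<)
open import Data.Fin.Induction using (<-weakInduction)
open import Data.Fin.Relation.Unary.Top using (view; ‵fromℕ; ‵inject₁)
open import Data.Product using (_×_; _,_; proj₁; proj₂)
open import Data.Sum using (_⊎_; inj₁; inj₂)
open import Function using (_∘_)
open import Function.Bundles using (Equivalence)
open import Relation.Nullary using (contradiction; yes; no)
open import Relation.Binary using (_Preserves_⟶_; tri<; tri≈; tri>)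
open import Relation.Binary.PropositionalEquality

m<n⇒m*o+p<n*o : ∀ {m n o p} → p < o → m < n → m * o + p < n * o
m<n⇒m*o+p<n*o {m} {n} {o} {p} p<o m<n = begin-strict
  m * o + p  <⟨ +-monoʳ-< (m * o) p<o ⟩
  m * o + o  ≡⟨ +-comm (m * o) o ⟩
  suc m * o  ≤⟨ *-monoˡ-≤ o m<n ⟩
  n * o      ∎
  where open ≤-Reasoning

m<n⇒m*o+p<n*o+q : ∀ {m n o p} q → p < o → m < n → m * o + p < n * o + q
m<n⇒m*o+p<n*o+q {n = n} {o} q p<o m<n = <-≤-trans (m<n⇒m*o+p<n*o p<o m<n) (m≤m+n (n * o) q)

m*o+p<n*o+q⇒m<n⊎m≡n×p<q : ∀ {m n o p q} → p < o → q < o →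
  m * o + p < n * o + q → m < n ⊎ (m ≡ n × p < q)
m*o+p<n*o+q⇒m<n⊎m≡n×p<q {m} {n} {o} {p} {q} p<o q<o lt with <-cmp m n
... | tri< m<n _ _  = inj₁ m<n
... | tri≈ _ refl _ = inj₂ (refl , +-cancelˡ-< (m * o) p q lt)
... | tri> _ _ n<m  = contradiction lt (<-asym (m<n⇒m*o+p<n*o+q p q<o n<m))

m*o+p≡n*o+q⇒m≡n×p≡q : ∀ {m n o p q} → p < o → q < o →
  m * o + p ≡ n * o + q → m ≡ n × p ≡ q
m*o+p≡n*o+q⇒m≡n×p≡q {m} {n} {o} {p} {q} p<o q<o eq with <-cmp m n
... | tri< m<n _ _  = contradiction eq (<⇒≢ (m<n⇒m*o+p<n*o+q q p<o m<n))
... | tri≈ _ refl _ = refl , +-cancelˡ-≡ (m * o) p q eq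
... | tri> _ _ n<m  = contradiction (sym eq) (<⇒≢ (m<n⇒m*o+p<n*o+q p q<o n<m))

[m*n+o]/n≡m : ∀ m {n o} .{{_ : NonZero n}} → o < n → (m * n + o) / n ≡ m
[m*n+o]/n≡m m {n} {o} o<n = begin
  (m * n + o) / n    ≡⟨ +-distrib-/ (m * n) o remainders<n ⟩
  m * n / n + o / n  ≡⟨ cong₂ _+_ (m*n/n≡m m n) (m<n⇒m/n≡0 o<n) ⟩
  m + 0              ≡⟨ +-identityʳ m ⟩
  m                  ∎
  where
  open ≡-Reasoning
  remainders<n : (m * n) % n + o % n < n
  remainders<n = subst (λ r → r + o % n < n) (sym (m*n%n≡0 m n)) (m%n<n o n)

n<m^n : ∀ {m} → 1 < m → ∀ n → n < m ^ n
n<m^n 1<m zero    = z<s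
n<m^n 1<m (suc n) = ≤-<-trans (n<m^n 1<m n) (^-monoʳ-< _ 1<m (n<1+n n))

%-+ʳ-cong : ∀ a b c n .{{_ : NonZero n}} → a % n ≡ b % n → (a + c) % n ≡ (b + c) % n
%-+ʳ-cong a b c n a≡b = begin
  (a + c) % n                ≡⟨ %-distribˡ-+ a c n ⟩
  (a % n + c % n) % n        ≡⟨ cong (λ r → (r + c % n) % n) a≡b ⟩
  (b % n + c % n) % n        ≡⟨ %-distribˡ-+ b c n ⟨
  (b + c) % n                ∎
  where open ≡-Reasoning

[m%n+o]%n≡[m+o]%n : ∀ m o n .{{_ : NonZero n}} → (m % n + o) % n ≡ (m + o) % n
[m%n+o]%n≡[m+o]%n m o n = %-+ʳ-cong (m % n) m o n (m%n%n≡m%n m n)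

-- m ≡ −1 modulo 1 + m, so t * m + (t + t′) ≡ t′.
*m%[1+m]-injective : ∀ {m t t′} → t < suc m → t′ < suc m →
  (t * m) % suc m ≡ (t′ * m) % suc m → t ≡ t′
*m%[1+m]-injective {m} {t} {t′} t<n t′<n eq = begin
  t                            ≡⟨ negate-back t′ t t<n ⟨
  (t′ * m + (t′ + t)) % suc m  ≡⟨ cong (λ s → (t′ * m + s) % suc m) (+-comm t′ t) ⟩
  (t′ * m + (t + t′)) % suc m  ≡⟨ %-+ʳ-cong (t * m) (t′ * m) (t + t′) (suc m) eq ⟨
  (t * m + (t + t′)) % suc m   ≡⟨ negate-back t t′ t′<n ⟩
  t′                           ∎
  where
  open ≡-Reasoning
  regroup : ∀ a b c → a * c + (a + b) ≡ b + a * suc c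
  regroup = solve-∀
  negate-back : ∀ a b → b < suc m → (a * m + (a + b)) % suc m ≡ b
  negate-back a b b<n = trans (cong (_% suc m) (regroup a b m))
                              (trans ([m+kn]%n≡m%n b a (suc m)) (m<n⇒m%n≡m b<n))

strictlyIncreasing⇒toℕ≤ : ∀ {n} (f : Fin (suc n) → ℕ) → f Preserves _<ᶠ_ ⟶ _<_ →
  ∀ i → toℕ i ≤ f i
strictlyIncreasing⇒toℕ≤ f mono = <-weakInduction (λ i → toℕ i ≤ f i) z≤n step
  where
  step : ∀ i → toℕ (inject₁ i) ≤ f (inject₁ i) → toℕ (fsuc i) ≤ f (fsuc i)
  step i le = <-≤-trans (s≤s (subst (_≤ f (inject₁ i)) (toℕ-inject₁ i) le))
                        (mono (s≤s (≤-reflexive (toℕ-inject₁ i))))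

strictlyIncreasing⇒≡toℕ : ∀ {n} (f : Fin n → ℕ) → f Preserves _<ᶠ_ ⟶ _<_ →
  (∀ i → f i < n) → ∀ i → f i ≡ toℕ i
strictlyIncreasing⇒≡toℕ {suc n} f mono bound i with view i
... | ‵fromℕ = ≤-antisym f[top]≤n (strictlyIncreasing⇒toℕ≤ f mono (fromℕ n))
  where
  f[top]≤n : f (fromℕ n) ≤ toℕ (fromℕ n)
  f[top]≤n = subst (f (fromℕ n) ≤_) (sym (toℕ-fromℕ n)) (s≤s⁻¹ (bound (fromℕ n)))
... | ‵inject₁ j =
  trans (strictlyIncreasing⇒≡toℕ (f ∘ inject₁) mono-inject₁ bound-inject₁ j)
        (sym (toℕ-inject₁ j))
  where
  mono-inject₁ : (f ∘ inject₁) Preserves _<ᶠ_ ⟶ _<_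
  mono-inject₁ {i} {j} i<j = mono (subst₂ _<_ (sym (toℕ-inject₁ i)) (sym (toℕ-inject₁ j)) i<j)
  bound-inject₁ : ∀ j → f (inject₁ j) < n
  bound-inject₁ j = <-≤-trans
    (mono (subst (toℕ (inject₁ j) <_) (sym (toℕ-fromℕ n)) (inject₁ℕ< j)))
    (s≤s⁻¹ (bound (fromℕ n)))

prefixValue : ∀ {k} → ℕ → (ℕ → Fin k) → ℕ
prefixValue zero        x = 0
prefixValue {k} (suc e) x = toℕ (x 0) * k ^ e + prefixValue e (x ∘ suc)

module _ {k : ℕ} where

  prefixValue-cong : ∀ e {x y : ℕ → Fin k} → (∀ j → j < e → x j ≡ y j) →
    prefixValue e x ≡ prefixValue e y
  prefixValue-cong zero    _   = refl
  prefixValue-cong (suc e) x≈y = cong₂ (λ c v → toℕ c * k ^ e + v) (x≈y 0 z<s)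
    (prefixValue-cong e (λ j j<e → x≈y (suc j) (s<s j<e)))

  prefixValue<k^e : ∀ e (x : ℕ → Fin k) → prefixValue e x < k ^ e
  prefixValue<k^e zero    x = z<s
  prefixValue<k^e (suc e) x = m<n⇒m*o+p<n*o (prefixValue<k^e e (x ∘ suc)) (toℕ<n (x 0))

  prefixValue-injective : ∀ e {x y : ℕ → Fin k} → prefixValue e x ≡ prefixValue e y →
    ∀ j → j < e → x j ≡ y j
  prefixValue-injective (suc e) {x} {y} eq j j<e
    with m*o+p≡n*o+q⇒m≡n×p≡q {toℕ (x 0)} {toℕ (y 0)}
           (prefixValue<k^e e (x ∘ suc)) (prefixValue<k^e e (y ∘ suc)) eq
  prefixValue-injective (suc e) eq zero    _   | heads , _ = toℕ-injective heads
  prefixValue-injective (suc e) eq (suc j) j<e | _ , tails =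
    prefixValue-injective e tails j (s≤s⁻¹ j<e)

  prefixValue-<-lex : ∀ e {q} {x y : ℕ → Fin k} → q < e →
    (∀ j → j < q → x j ≡ y j) → x q <ᶠ y q → prefixValue e x < prefixValue e y
  prefixValue-<-lex (suc e) {zero} {x} _ _ lt =
    m<n⇒m*o+p<n*o+q _ (prefixValue<k^e e (x ∘ suc)) lt
  prefixValue-<-lex (suc e) {suc q} {x} {y} q<e agree lt =
    subst (λ c → prefixValue (suc e) x < toℕ c * k ^ e + prefixValue e (y ∘ suc))
      (agree 0 z<s)
      (+-monoʳ-< (toℕ (x 0) * k ^ e)
        (prefixValue-<-lex e (s≤s⁻¹ q<e) (λ j j<q → agree (suc j) (s<s j<q)) lt))

  prefixValue-≤-lex : ∀ e {q} {x y : ℕ → Fin k} → (∀ j → j < q → x j ≡ y j) →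
    x q <ᶠ y q → prefixValue e x ≤ prefixValue e y
  prefixValue-≤-lex e {q} agree lt with q <? e
  ... | yes q<e = <⇒≤ (prefixValue-<-lex e q<e agree lt)
  ... | no  q≮e =
    ≤-reflexive (prefixValue-cong e (λ j j<e → agree j (<-≤-trans j<e (≮⇒≥ q≮e))))

  prefixValue-snoc : ∀ e (x : ℕ → Fin k) →
    prefixValue (suc e) x ≡ prefixValue e x * k + toℕ (x e)
  prefixValue-snoc zero    x = trans (+-identityʳ _) (*-identityʳ _)
  prefixValue-snoc (suc e) x = begin
    toℕ (x 0) * (k * k ^ e) + prefixValue (suc e) (x ∘ suc)
      ≡⟨ cong (toℕ (x 0) * (k * k ^ e) +_) (prefixValue-snoc e (x ∘ suc)) ⟩
    toℕ (x 0) * (k * k ^ e) + (prefixValue e (x ∘ suc) * k + toℕ (x (suc e)))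
      ≡⟨ regroup (toℕ (x 0)) (k ^ e) (prefixValue e (x ∘ suc)) (toℕ (x (suc e))) k ⟩
    (toℕ (x 0) * k ^ e + prefixValue e (x ∘ suc)) * k + toℕ (x (suc e))
      ∎
    where
    open ≡-Reasoning
    regroup : ∀ a p t c k → a * (k * p) + (t * k + c) ≡ (a * p + t) * k + c
    regroup = solve-∀

  fromDigits≡prefixValue : ∀ e (f : Word k e) (x : ℕ → Fin k) →
    (∀ j → f j ≡ x (toℕ j)) → fromDigits e f ≡ prefixValue e x
  fromDigits≡prefixValue zero    f x f≈x = refl
  fromDigits≡prefixValue (suc e) f x f≈x = cong₂ (λ c v → toℕ c * k ^ e + v)
    (f≈x fzero) (fromDigits≡prefixValue e (f ∘ fsuc) (x ∘ suc) (f≈x ∘ fsuc))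

  letters-agree : ∀ {n} {a b : Word k n} {x y : ℕ → Fin k} →
    (∀ j → a j ≡ x (toℕ j)) → (∀ j → b j ≡ y (toℕ j)) →
    ∀ j (j<n : j < n) → a (fromℕ< j<n) ≡ b (fromℕ< j<n) → x j ≡ y j
  letters-agree {a = a} {b} {x} {y} a≈x b≈y j j<n eq = begin
    x j                     ≡⟨ cong x (toℕ-fromℕ< j<n) ⟨
    x (toℕ (fromℕ< j<n))    ≡⟨ a≈x _ ⟨
    a (fromℕ< j<n)          ≡⟨ eq ⟩
    b (fromℕ< j<n)          ≡⟨ b≈y _ ⟩
    y (toℕ (fromℕ< j<n))    ≡⟨ cong y (toℕ-fromℕ< j<n) ⟩
    y j                     ∎
    where open ≡-Reasoning

  LexLe⇒prefixValue-≤ : ∀ {e n} {a b : Word k n} {x y : ℕ → Fin k} → e ≤ n →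
    (∀ j → a j ≡ x (toℕ j)) → (∀ j → b j ≡ y (toℕ j)) →
    LexLe a b → prefixValue e x ≤ prefixValue e y
  LexLe⇒prefixValue-≤ {e} e≤n a≈x b≈y (inj₁ a≗b) = ≤-reflexive
    (prefixValue-cong e (λ j j<e → letters-agree a≈x b≈y j (<-≤-trans j<e e≤n) (a≗b _)))
  LexLe⇒prefixValue-≤ {e} e≤n a≈x b≈y (inj₂ (p , same , lt)) =
    prefixValue-≤-lex e
      (λ j j<p → letters-agree a≈x b≈y j (<-trans j<p (toℕ<n p))
        (same _ (subst (_< toℕ p) (sym (toℕ-fromℕ< _)) j<p)))
      (subst₂ _<ᶠ_ (a≈x p) (b≈y p) lt)

IsDeBruijn⇒factor-injective : ∀ {k n d} {w : Word k n} → IsDeBruijn d w →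
  ∀ {i j} → factor d w i ≗ factor d w j → i ≡ j
IsDeBruijn⇒factor-injective {d = d} {w} db {i} {j} i≈j with db (factor d w j)
... | _ , _ , unique = trans (unique i i≈j) (sym (unique j (λ _ → refl)))

module CyclicWord {k m : ℕ} (w : Word k (suc m)) where

  at : ℕ → Fin k
  at a = w (fromℕ< (m%n<n a (suc m)))

  at-cong-% : ∀ a b → a % suc m ≡ b % suc m → at a ≡ at b
  at-cong-% _ _ eq = cong w (fromℕ<-cong _ _ eq _ _)

  w≡at : ∀ i → w i ≡ at (toℕ i)
  w≡at i = cong w (sym (trans (fromℕ<-cong _ _ (m<n⇒m%n≡m (toℕ<n i)) _ (toℕ<n i))
                              (fromℕ<-toℕ i _)))

  -- σ moves the letter at index j − 1 to index j, and −1 ≡ m modulo 1 + m.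
  rot≡at : ∀ t j → rot w t j ≡ at (toℕ j + t * m)
  rot≡at zero    j = trans (w≡at j) (cong at (sym (+-identityʳ (toℕ j))))
  rot≡at (suc t) j = begin
    rot w t (j ⊕ m)             ≡⟨ rot≡at t (j ⊕ m) ⟩
    at (toℕ (j ⊕ m) + t * m)
      ≡⟨ cong (λ a → at (a + t * m)) (toℕ-fromℕ< (m%n<n (toℕ j + m) (suc m))) ⟩
    at ((toℕ j + m) % suc m + t * m)
      ≡⟨ at-cong-% ((toℕ j + m) % suc m + t * m) (toℕ j + m + t * m)
           ([m%n+o]%n≡[m+o]%n (toℕ j + m) (t * m) (suc m)) ⟩
    at (toℕ j + m + t * m)      ≡⟨ cong at (+-assoc (toℕ j) m (t * m)) ⟩
    at (toℕ j + suc t * m)      ∎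
    where open ≡-Reasoning

  window : ℕ → ℕ → Fin k
  window a j = at (a + j)

  prefixValue-window-suc : ∀ e a → prefixValue (suc e) (window a) ≡
    toℕ (at a) * k ^ e + prefixValue e (window (a + 1))
  prefixValue-window-suc e a = cong₂ (λ c v → toℕ c * k ^ e + v) (cong at (+-identityʳ a))
    (prefixValue-cong e (λ j _ → cong at (sym (+-assoc a 1 j))))

  module Windows (d : ℕ) where

    u : ℕ → ℕ
    u a = prefixValue d (window a)

    uval≡u : ∀ i → uval d w i ≡ u (toℕ i)
    uval≡u i = fromDigits≡prefixValue d _ _ (λ _ → refl)

    u-cong-% : ∀ a b → a % suc m ≡ b % suc m → u a ≡ u b
    u-cong-% a b eq =
      prefixValue-cong d (λ j _ → at-cong-% (a + j) (b + j) (%-+ʳ-cong a b j (suc m) eq))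

    uval-⊕ : ∀ i a → uval d w (i ⊕ a) ≡ u (toℕ i + a)
    uval-⊕ i a = trans (uval≡u (i ⊕ a))
      (trans (cong u (toℕ-fromℕ< (m%n<n (toℕ i + a) (suc m))))
             (u-cong-% ((toℕ i + a) % suc m) (toℕ i + a) (m%n%n≡m%n (toℕ i + a) (suc m))))

    u-injective-% : IsDeBruijn d w → ∀ a b → u a ≡ u b → a % suc m ≡ b % suc m
    u-injective-% db a b eq = begin
      a % suc m          ≡⟨ toℕ-fromℕ< (m%n<n a (suc m)) ⟨
      toℕ (position a)   ≡⟨ cong toℕ (IsDeBruijn⇒factor-injective {w = w} db factors-agree) ⟩
      toℕ (position b)   ≡⟨ toℕ-fromℕ< (m%n<n b (suc m)) ⟩
      b % suc m          ∎
      where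
      open ≡-Reasoning
      position : ℕ → Fin (suc m)
      position c = fromℕ< (m%n<n c (suc m))
      factor-position : ∀ c j → factor d w (position c) j ≡ window c (toℕ j)
      factor-position c j = at-cong-% (toℕ (position c) + toℕ j) (c + toℕ j)
        (trans (cong (λ r → (r + toℕ j) % suc m) (toℕ-fromℕ< (m%n<n c (suc m))))
               ([m%n+o]%n≡[m+o]%n c (toℕ j) (suc m)))
      factors-agree : factor d w (position a) ≗ factor d w (position b)
      factors-agree j = trans (factor-position a j)
        (trans (prefixValue-injective d eq (toℕ j) (toℕ<n j)) (sym (factor-position b j)))

module LFMapping {k d′ m : ℕ} (k^d≡n : k ^ suc d′ ≡ suc m) (hk : 2 ≤ k)
  (w : Word k (suc m)) (db : IsDeBruijn (suc d′) w)
  (M : Fin (suc m) → Word k (suc m)) (bw : IsBWMatrix w M) where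

  open CyclicWord w
  open Windows (suc d′)

  u<n : ∀ a → u a < suc m
  u<n a = subst (u a <_) k^d≡n (prefixValue<k^e (suc d′) (window a))

  d≤n : suc d′ ≤ suc m
  d≤n = subst (suc d′ ≤_) k^d≡n (<⇒≤ (n<m^n hk (suc d′)))

  ρ : Fin (suc m) → Fin (suc m)
  ρ = proj₁ (proj₁ bw)

  -- Row r of M is σ^(ρ r)(w), which starts at index start r of w.
  start : Fin (suc m) → ℕ
  start r = toℕ (ρ r) * m

  M≡window : ∀ r j → M r j ≡ window (start r) (toℕ j)
  M≡window r j = trans (proj₂ (proj₂ (proj₁ bw)) r j)
    (trans (rot≡at (toℕ (ρ r)) j) (cong at (+-comm (toℕ j) (start r))))

  start-injective-% : ∀ {r s} → start r % suc m ≡ start s % suc m → r ≡ s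
  start-injective-% {r} {s} eq = proj₁ (proj₁ (proj₂ (proj₁ bw)))
    (toℕ-injective (*m%[1+m]-injective (toℕ<n (ρ r)) (toℕ<n (ρ s)) eq))

  -- The rows are sorted, and distinct rows have distinct length-d prefixes.
  u-start : ∀ r → u (start r) ≡ toℕ r
  u-start = strictlyIncreasing⇒≡toℕ (u ∘ start) increasing (u<n ∘ start)
    where
    increasing : (u ∘ start) Preserves _<ᶠ_ ⟶ _<_
    increasing {r} {s} r<s = ≤∧≢⇒<
      (LexLe⇒prefixValue-≤ {x = window (start r)} {window (start s)}
        d≤n (M≡window r) (M≡window s) (proj₂ bw r s (<⇒≤ r<s)))
      (λ eq → <⇒≢ r<s
        (cong toℕ (start-injective-% (u-injective-% db (start r) (start s) eq))))

  rowOf : ℕ → Fin (suc m)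
  rowOf a = fromℕ< (u<n a)

  start-rowOf : ∀ a → start (rowOf a) % suc m ≡ a % suc m
  start-rowOf a =
    u-injective-% db (start (rowOf a)) a (trans (u-start (rowOf a)) (toℕ-fromℕ< (u<n a)))

  next : Fin (suc m) → Fin (suc m)
  next r = rowOf (start r + 1)

  lastCol-next : ∀ r → lastCol M (next r) ≡ at (start r)
  lastCol-next r = begin
    M (next r) (fromℕ m)
      ≡⟨ M≡window (next r) (fromℕ m) ⟩
    at (start (next r) + toℕ (fromℕ m))
      ≡⟨ cong (λ j → at (start (next r) + j)) (toℕ-fromℕ m) ⟩
    at (start (next r) + m)
      ≡⟨ at-cong-% (start (next r) + m) (start r + 1 + m)
           (%-+ʳ-cong (start (next r)) (start r + 1) m (suc m) (start-rowOf (start r + 1))) ⟩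
    at (start r + 1 + m)
      ≡⟨ cong at (+-assoc (start r) 1 m) ⟩
    at (start r + suc m)
      ≡⟨ at-cong-% (start r + suc m) (start r) ([m+n]%n≡m%n (start r) (suc m)) ⟩
    at (start r)
      ∎
    where open ≡-Reasoning

  tail : Fin (suc m) → ℕ
  tail r = prefixValue d′ (window (start r + 1))

  toℕ≡head+tail : ∀ r → toℕ r ≡ toℕ (at (start r)) * k ^ d′ + tail r
  toℕ≡head+tail r = trans (sym (u-start r)) (prefixValue-window-suc d′ (start r))

  toℕ-next : ∀ r → toℕ (next r) ≡ tail r * k + toℕ (at (start r + 1 + d′))
  toℕ-next r =
    trans (toℕ-fromℕ< (u<n (start r + 1))) (prefixValue-snoc d′ (window (start r + 1)))

  next-order : ∀ {r s} → r <ᶠ s →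
    at (start r) <ᶠ at (start s) ⊎ (at (start r) ≡ at (start s) × next r <ᶠ next s)
  next-order {r} {s} r<s
    with m*o+p<n*o+q⇒m<n⊎m≡n×p<q {toℕ (at (start r))} {toℕ (at (start s))}
           (prefixValue<k^e d′ _) (prefixValue<k^e d′ _)
           (subst₂ _<_ (toℕ≡head+tail r) (toℕ≡head+tail s) r<s)
  ... | inj₁ heads< = inj₁ heads<
  ... | inj₂ (heads≡ , tails<) = inj₂ (toℕ-injective heads≡ ,
    subst₂ _<_ (sym (toℕ-next r)) (sym (toℕ-next s)) (m<n⇒m*o+p<n*o+q _ (toℕ<n _) tails<))

  π∘next≡id : ∀ π → IsStdPerm (lastCol M) π → ∀ r → π (next r) ≡ r
  π∘next≡id π sp r = toℕ-injective
    (strictlyIncreasing⇒≡toℕ (toℕ ∘ π ∘ next) increasing (toℕ<n ∘ π ∘ next) r)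
    where
    increasing : (toℕ ∘ π ∘ next) Preserves _<ᶠ_ ⟶ _<_
    increasing {r} {s} r<s = Equivalence.from (sp (next r) (next s))
      (subst₂ (λ a b → a <ᶠ b ⊎ (a ≡ b × next r <ᶠ next s))
        (sym (lastCol-next r)) (sym (lastCol-next s)) (next-order r<s))

  toℕ-next≡u[a+1] : ∀ a j → toℕ j ≡ u a → toℕ (next j) ≡ u (a + 1)
  toℕ-next≡u[a+1] a j j≡uₐ = trans (toℕ-fromℕ< (u<n (start j + 1)))
    (u-cong-% (start j + 1) (a + 1)
      (%-+ʳ-cong (start j) a 1 (suc m)
        (u-injective-% db (start j) a (trans (u-start j) j≡uₐ))))

  instance
    k^d′≢0 : NonZero (k ^ d′)
    k^d′≢0 = pow-nonZero hk d′

  w≡u/k^d′ : ∀ i → toℕ (w i) ≡ u (toℕ i) / k ^ d′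
  w≡u/k^d′ i = begin
    toℕ (w i)
      ≡⟨ cong toℕ (w≡at i) ⟩
    toℕ (at (toℕ i))
      ≡⟨ [m*n+o]/n≡m _ (prefixValue<k^e d′ (window (toℕ i + 1))) ⟨
    (toℕ (at (toℕ i)) * k ^ d′ + prefixValue d′ (window (toℕ i + 1))) / k ^ d′
      ≡⟨ cong (_/ k ^ d′) (prefixValue-window-suc d′ (toℕ i)) ⟨
    u (toℕ i) / k ^ d′
      ∎
    where open ≡-Reasoning

lemma5 : (k d : ℕ) (hk : 2 ≤ k) → 1 ≤ d →
    (w : Word k (k ^ d)) → IsDeBruijn d w →
    (M : Fin (k ^ d) → Word k (k ^ d)) → IsBWMatrix w M →
    (π π⁻¹ : Fin (k ^ d) → Fin (k ^ d)) → IsStdPerm (lastCol M) π →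
    (∀ i → π⁻¹ (π i) ≡ i) → (∀ i → π (π⁻¹ i) ≡ i) →
    (∀ i j → toℕ j ≡ uval d w i → toℕ (π⁻¹ j) ≡ uval d w (i ⊕ 1))
    × (∀ i → toℕ (w i) ≡ _/_ (uval d w i) (k ^ (d ∸ 1)) {{pow-nonZero hk (d ∸ 1)}})
lemma5 k (suc d′) hk _ w db M bw π π⁻¹ sp π⁻¹∘π _ with k ^ suc d′ in k^d≡n
... | zero  = (λ _ ()) , (λ ())
... | suc m = π⁻¹-shifts-windows ,
              λ i → trans (w≡u/k^d′ i) (cong (_/ k ^ d′) (sym (uval≡u i)))
  where
  open LFMapping k^d≡n hk w db M bw
  open CyclicWord.Windows w (suc d′)

  π⁻¹-shifts-windows : ∀ i j → toℕ j ≡ uval (suc d′) w i →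
    toℕ (π⁻¹ j) ≡ uval (suc d′) w (i ⊕ 1)
  π⁻¹-shifts-windows i j j≡uᵢ = begin
    toℕ (π⁻¹ j)              ≡⟨ cong (toℕ ∘ π⁻¹) (π∘next≡id π sp j) ⟨
    toℕ (π⁻¹ (π (next j)))   ≡⟨ cong toℕ (π⁻¹∘π (next j)) ⟩
    toℕ (next j)             ≡⟨ toℕ-next≡u[a+1] (toℕ i) j (trans j≡uᵢ (uval≡u i)) ⟩
    u (toℕ i + 1)            ≡⟨ uval-⊕ i 1 ⟨
    uval (suc d′) w (i ⊕ 1)  ∎
    where open ≡-Reasoning
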